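{- Let $n$ be a non-negative integer and $s$ any integer. Then \[ \sum_{j = 0}^n \frac{F_{j + n + s}}{\binom nj} = (n + 1)\sum_{j = 0}^n \frac{F_{j + s - 2} + F_{2j + s - 1}}{j + 1}, \qquad \sum_{j = 0}^n \frac{L_{j + n + s}}{\binom nj} = (n + 1)\sum_{j = 0}^n \frac{L_{j + s - 2} + L_{2j + s - 1}}{j + 1}. \]
   Context: $F_j$ and $L_j$ denote the Fibonacci and Lucas numbers, defined for all integers $j$ by $F_0=0$, $F_1=1$, $L_0=2$, $L_1=1$, $F_j=F_{j-1}+F_{j-2}$, $L_j=L_{j-1}+L_{j-2}$, extended to negative indices by $F_{ -j}=(-1)^{j-1}F_j$, $L_{ -j}=(-1)^jL_j$; equivalently $F_j=(\alpha^j-\beta^j)/(\alpha-\beta)$, $L_j=\alpha^j+\beta^j$ with $\alpha=(1+\sqrt5)/2$, $\beta=(1-\sqrt5)/2$. For non-negative integers $i,j$, $\binom ij=\frac{i!}{j!(i-j)!}$ if $i\ge j$. -}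

module Defs where

open import Data.Nat as ℕ using (ℕ; zero; suc; NonZero; _≤_; z≤n; s≤s)
open import Data.Nat.Combinatorics using (_C_; nCk+nC[k+1]≡[n+1]C[k+1])
open import Relation.Binary.PropositionalEquality using (sym)
open import Data.Integer as ℤ using (ℤ; +_; -[1+_])
open import Data.Rational as ℚ using (ℚ)
open import Data.Fin as Fin using (Fin; toℕ)
import Data.Nat.Properties as NP
open import Data.Fin.Properties using (toℕ≤pred[n])

fibℕ : ℕ → ℤ
fibℕ 0 = + 0
fibℕ 1 = + 1
fibℕ (suc (suc n)) = fibℕ (suc n) ℤ.+ fibℕ n

lucℕ : ℕ → ℤ
lucℕ 0 = + 2
lucℕ 1 = + 1
lucℕ (suc (suc n)) = lucℕ (suc n) ℤ.+ lucℕ n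

sgn : ℕ → ℤ
sgn 0 = + 1
sgn (suc k) = ℤ.- sgn k

F : ℤ → ℤ
F (+ n) = fibℕ n
F -[1+ k ] = sgn k ℤ.* fibℕ (suc k)

L : ℤ → ℤ
L (+ n) = lucℕ n
L -[1+ k ] = sgn (suc k) ℤ.* lucℕ (suc k)

C-pos : ∀ n j → j ≤ n → NonZero (n C j)
C-pos n zero _ = _
C-pos (suc n) (suc j) (s≤s j≤n) with C-pos n j j≤n
... | nz rewrite sym (nCk+nC[k+1]≡[n+1]C[k+1] n j) =
  ℕ.>-nonZero (NP.<-≤-trans (ℕ.>-nonZero⁻¹ (n C j) {{nz}}) (NP.m≤m+n (n C j) (n C suc j)))

Σ : (m : ℕ) → (Fin m → ℚ) → ℚ
Σ zero f = ℚ.0ℚ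
Σ (suc m) f = f Fin.zero ℚ.+ Σ m (λ i → f (Fin.suc i))

_/C[_,_] : ℤ → (n : ℕ) → Fin (suc n) → ℚ
z /C[ n , j ] = (z ℚ./ (n C toℕ j)) {{C-pos n (toℕ j) (toℕ≤pred[n] j)}}

-- Put φ m = G (m + s − 2) for G = F or L. Then the identity reads
--   Sₙ := Σ_{k≤n} φ(n+k+2)/C(n,k) = (n+1) Σ_{k≤n} (φ k + φ(2k+1))/(k+1)
-- and only uses φ(m+2) = φ(m+1) + φ(m). Splitting every φ(n+k+3) in S_{n+1} by this recurrence
-- and shifting k in the second half, the terms pair up through
--   1/C(n+1,k) + 1/C(n+1,k+1) = (n+2) / ((n+1) C(n,k)),
-- which follows from the absorption identity (k+1) C(n+1,k+1) = (n+1) C(n,k); the two unpaired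
-- end terms are φ(2n+3) and φ(n+1). So S_{n+1} = (n+2)/(n+1) Sₙ + φ(n+1) + φ(2n+3), which is
-- the recurrence satisfied by the right-hand side.
module Submission where

open import Defs

module _ where
  open import Data.Nat using (ℕ; zero; suc; _+_; _*_)
  open import Data.Nat.Properties using (*-zeroʳ; *-identityˡ; *-identityʳ; *-distribˡ-+; +-assoc)
  open import Data.Nat.Combinatorics using (_C_; nCk+nC[k+1]≡[n+1]C[k+1]; nC1≡n)
  open import Relation.Binary.PropositionalEquality
  open ≡-Reasoning

  [k+1]*[n+1]C[k+1]≡[n+1]*nCk : ∀ n k → suc k * (suc n C suc k) ≡ suc n * (n C k)
  [k+1]*[n+1]C[k+1]≡[n+1]*nCk zero    zero    = refl
  [k+1]*[n+1]C[k+1]≡[n+1]*nCk zero    (suc k) = *-zeroʳ (suc (suc k))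
  [k+1]*[n+1]C[k+1]≡[n+1]*nCk (suc n) zero    =
    trans (*-identityˡ _) (trans (nC1≡n (suc (suc n))) (sym (*-identityʳ (suc (suc n)))))
  [k+1]*[n+1]C[k+1]≡[n+1]*nCk (suc n) (suc k) = begin
    suc (suc k) * (suc (suc n) C suc (suc k))
      ≡⟨ cong (suc (suc k) *_) (sym (nCk+nC[k+1]≡[n+1]C[k+1] (suc n) (suc k))) ⟩
    suc (suc k) * (a + b)
      ≡⟨ *-distribˡ-+ (suc (suc k)) a b ⟩
    (a + suc k * a) + suc (suc k) * b
      ≡⟨ +-assoc a (suc k * a) (suc (suc k) * b) ⟩
    a + (suc k * a + suc (suc k) * b)
      ≡⟨ cong₂ (λ x y → a + (x + y)) ([k+1]*[n+1]C[k+1]≡[n+1]*nCk n k) ([k+1]*[n+1]C[k+1]≡[n+1]*nCk n (suc k)) ⟩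
    a + (suc n * (n C k) + suc n * (n C suc k))
      ≡⟨ cong (a +_) (sym (*-distribˡ-+ (suc n) (n C k) (n C suc k))) ⟩
    a + suc n * (n C k + n C suc k)
      ≡⟨ cong (λ x → a + suc n * x) (nCk+nC[k+1]≡[n+1]C[k+1] n k) ⟩
    suc (suc n) * a ∎
    where
    a = suc n C suc k
    b = suc n C suc (suc k)

module _ where
  open import Data.Nat as ℕ using (ℕ; zero; suc; NonZero)
  import Data.Nat.Properties as ℕ
  open import Data.Integer using (ℤ; +_; _+_; _*_)
  import Data.Integer.Properties as ℤ
  open import Data.Rational using (ℚ; _/_; 0ℚ; 1ℚ; fromℚᵘ)
    renaming (_+_ to _+ℚ_; _*_ to _*ℚ_)
  open import Data.Rational.Properties
    using (toℚᵘ-homo-+; toℚᵘ-homo-*; toℚᵘ-fromℚᵘ; fromℚᵘ-toℚᵘ; fromℚᵘ-cong; /-cong; *-zeroˡ; *-zeroʳ; *-assoc; *-comm; *-identityˡ)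
  open import Data.Rational.Unnormalised as ℚᵘ using (mkℚᵘ; *≡*)
  import Data.Rational.Unnormalised.Properties as ℚᵘ
  open import Relation.Binary.PropositionalEquality
  open ≡-Reasoning

  toℚ : ℤ → ℚ
  toℚ z = z / 1

  -- recip 0 = 0 is a junk value.
  recip : ℕ → ℚ
  recip zero    = 0ℚ
  recip (suc d) = + 1 / suc d

  -- z / suc d is definitionally fromℚᵘ (mkℚᵘ z d), and ℚᵘ arithmetic computes on numerators and
  -- denominators; so these two lemmas reduce identities between fractions to identities in ℤ.
  fromℚᵘ-homo-+ : ∀ p q → fromℚᵘ (p ℚᵘ.+ q) ≡ fromℚᵘ p +ℚ fromℚᵘ q
  fromℚᵘ-homo-+ p q = sym (trans (sym (fromℚᵘ-toℚᵘ _)) (fromℚᵘ-cong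
    (ℚᵘ.≃-trans (toℚᵘ-homo-+ (fromℚᵘ p) (fromℚᵘ q)) (ℚᵘ.+-cong (toℚᵘ-fromℚᵘ p) (toℚᵘ-fromℚᵘ q)))))

  fromℚᵘ-homo-* : ∀ p q → fromℚᵘ (p ℚᵘ.* q) ≡ fromℚᵘ p *ℚ fromℚᵘ q
  fromℚᵘ-homo-* p q = sym (trans (sym (fromℚᵘ-toℚᵘ _)) (fromℚᵘ-cong
    (ℚᵘ.≃-trans (toℚᵘ-homo-* (fromℚᵘ p) (fromℚᵘ q)) (ℚᵘ.*-cong (toℚᵘ-fromℚᵘ p) (toℚᵘ-fromℚᵘ q)))))

  fraction-cross : ∀ x y d e → x * + suc e ≡ y * + suc d → x / suc d ≡ y / suc e
  fraction-cross x y d e eq = fromℚᵘ-cong {mkℚᵘ x d} {mkℚᵘ y e} (*≡* eq)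

  toℚ-homo-+ : ∀ a b → toℚ (a + b) ≡ toℚ a +ℚ toℚ b
  toℚ-homo-+ a b = trans
    (cong (_/ 1) (sym (cong₂ _+_ (ℤ.*-identityʳ a) (ℤ.*-identityʳ b))))
    (fromℚᵘ-homo-+ (mkℚᵘ a 0) (mkℚᵘ b 0))

  z/d≡toℚ[z]*recip[d] : ∀ z d .{{_ : NonZero d}} → z / d ≡ toℚ z *ℚ recip d
  z/d≡toℚ[z]*recip[d] z (suc d) = trans
    (/-cong (sym (ℤ.*-identityʳ z)) (sym (ℕ.*-identityˡ (suc d))))
    (fromℚᵘ-homo-* (mkℚᵘ z 0) (mkℚᵘ (+ 1) d))

  toℚ[d]*recip[d]≡1 : ∀ d .{{_ : NonZero d}} → toℚ (+ d) *ℚ recip d ≡ 1ℚ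
  toℚ[d]*recip[d]≡1 (suc d) = trans (sym (z/d≡toℚ[z]*recip[d] (+ suc d) (suc d)))
    (fraction-cross (+ suc d) (+ 1) d 0 (ℤ.*-comm (+ suc d) (+ 1)))

  recip[d]*[toℚ[d]*x]≡x : ∀ d .{{_ : NonZero d}} x → recip d *ℚ (toℚ (+ d) *ℚ x) ≡ x
  recip[d]*[toℚ[d]*x]≡x d x = begin
    recip d *ℚ (toℚ (+ d) *ℚ x) ≡⟨ *-assoc (recip d) (toℚ (+ d)) x ⟨
    (recip d *ℚ toℚ (+ d)) *ℚ x ≡⟨ cong (_*ℚ x) (*-comm (recip d) (toℚ (+ d))) ⟩
    (toℚ (+ d) *ℚ recip d) *ℚ x ≡⟨ cong (_*ℚ x) (toℚ[d]*recip[d]≡1 d) ⟩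
    1ℚ *ℚ x                     ≡⟨ *-identityˡ x ⟩
    x                           ∎

  toℚ[d]*[x*recip[d]]≡x : ∀ d .{{_ : NonZero d}} x → toℚ (+ d) *ℚ (x *ℚ recip d) ≡ x
  toℚ[d]*[x*recip[d]]≡x d x = begin
    toℚ (+ d) *ℚ (x *ℚ recip d) ≡⟨ cong (toℚ (+ d) *ℚ_) (*-comm x (recip d)) ⟩
    toℚ (+ d) *ℚ (recip d *ℚ x) ≡⟨ *-assoc (toℚ (+ d)) (recip d) x ⟨
    (toℚ (+ d) *ℚ recip d) *ℚ x ≡⟨ cong (_*ℚ x) (toℚ[d]*recip[d]≡1 d) ⟩
    1ℚ *ℚ x                     ≡⟨ *-identityˡ x ⟩
    x                           ∎

  recip-homo-* : ∀ a b → recip (a ℕ.* b) ≡ recip a *ℚ recip b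
  recip-homo-* zero    b       = sym (*-zeroˡ (recip b))
  recip-homo-* (suc a) zero    = trans (cong recip (ℕ.*-zeroʳ (suc a))) (sym (*-zeroʳ (recip (suc a))))
  recip-homo-* (suc a) (suc b) = fromℚᵘ-homo-* (mkℚᵘ (+ 1) a) (mkℚᵘ (+ 1) b)

  recip[a]+recip[b]≡toℚ[a+b]*recip[a*b] : ∀ a b .{{_ : NonZero a}} .{{_ : NonZero b}} →
    recip a +ℚ recip b ≡ toℚ (+ (a ℕ.+ b)) *ℚ recip (a ℕ.* b)
  recip[a]+recip[b]≡toℚ[a+b]*recip[a*b] (suc a) (suc b) = begin
    recip (suc a) +ℚ recip (suc b)
      ≡⟨ sym (fromℚᵘ-homo-+ (mkℚᵘ (+ 1) a) (mkℚᵘ (+ 1) b)) ⟩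
    (+ 1 * + suc b + + 1 * + suc a) / (suc a ℕ.* suc b)
      ≡⟨ cong (_/ (suc a ℕ.* suc b)) (begin
         + 1 * + suc b + + 1 * + suc a ≡⟨ cong₂ _+_ (ℤ.*-identityˡ (+ suc b)) (ℤ.*-identityˡ (+ suc a)) ⟩
         + (suc b ℕ.+ suc a)           ≡⟨ cong +_ (ℕ.+-comm (suc b) (suc a)) ⟩
         + (suc a ℕ.+ suc b)           ∎) ⟩
    + (suc a ℕ.+ suc b) / (suc a ℕ.* suc b)
      ≡⟨ z/d≡toℚ[z]*recip[d] (+ (suc a ℕ.+ suc b)) (suc a ℕ.* suc b) ⟩
    toℚ (+ (suc a ℕ.+ suc b)) *ℚ recip (suc a ℕ.* suc b) ∎

  toℚ-*-recip-cross : ∀ x y d e .{{_ : NonZero d}} .{{_ : NonZero e}} → x ℕ.* e ≡ y ℕ.* d →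
    toℚ (+ x) *ℚ recip d ≡ toℚ (+ y) *ℚ recip e
  toℚ-*-recip-cross x y (suc d) (suc e) xe≡yd = begin
    toℚ (+ x) *ℚ recip (suc d) ≡⟨ sym (z/d≡toℚ[z]*recip[d] (+ x) (suc d)) ⟩
    + x / suc d                ≡⟨ fraction-cross (+ x) (+ y) d e (begin
                                    + x * + suc e ≡⟨ ℤ.pos-* x (suc e) ⟨
                                    + (x ℕ.* suc e) ≡⟨ cong +_ xe≡yd ⟩
                                    + (y ℕ.* suc d) ≡⟨ ℤ.pos-* y (suc d) ⟩
                                    + y * + suc d ∎) ⟩
    + y / suc e                ≡⟨ z/d≡toℚ[z]*recip[d] (+ y) (suc e) ⟩
    toℚ (+ y) *ℚ recip (suc e) ∎

module _ where
  open import Data.Nat using (ℕ; zero; suc; _+_; _*_; _≤_; s≤s; NonZero)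
  open import Data.Nat.Properties using (*-assoc; *-comm; m≤n⇒m≤1+n; m*n≢0; +-suc; +-identityʳ)
  open import Data.Nat.Combinatorics using (_C_; nCk+nC[k+1]≡[n+1]C[k+1]; nCn≡1)
  open import Data.Fin using (toℕ)
  open import Data.Fin.Properties using (toℕ-inject₁; toℕ-fromℕ; toℕ≤pred[n])
  open import Data.Integer using (+_)
  open import Data.Rational using (ℚ; 0ℚ; 1ℚ) renaming (_+_ to _+ℚ_; _*_ to _*ℚ_)
  import Data.Rational.Properties as ℚ
  open import Data.Rational.Solver using (module +-*-Solver)
  open +-*-Solver using (solve; con; _:+_; _:*_; _:=_)
  open import Algebra.Bundles using (Ring)
  open import Algebra.Properties.Semiring.Sum (Ring.semiring ℚ.+-*-ring)
    using (sum-syntax; sum-cong-≗; sum-init-last; ∑-distrib-+; *-distribˡ-sum)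
  open import Data.Nat.Tactic.RingSolver using (solve-∀)
  open import Relation.Binary.PropositionalEquality
  open ≡-Reasoning

  recip[n+1]Ck+recip[n+1]C[k+1] : ∀ {n k} → k ≤ n →
    recip (suc n C k) +ℚ recip (suc n C suc k) ≡ toℚ (+ suc (suc n)) *ℚ (recip (suc n) *ℚ recip (n C k))
  recip[n+1]Ck+recip[n+1]C[k+1] {n} {k} k≤n = begin
    recip a +ℚ recip b                       ≡⟨ recip[a]+recip[b]≡toℚ[a+b]*recip[a*b] a b ⟩
    toℚ (+ (a + b)) *ℚ recip (a * b)         ≡⟨ toℚ-*-recip-cross (a + b) (suc (suc n)) (a * b) (suc n * c) cleared ⟩
    toℚ (+ suc (suc n)) *ℚ recip (suc n * c) ≡⟨ cong (toℚ (+ suc (suc n)) *ℚ_) (recip-homo-* (suc n) c) ⟩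
    toℚ (+ suc (suc n)) *ℚ (recip (suc n) *ℚ recip c) ∎
    where
    a = suc n C k
    b = suc n C suc k
    c = n C k
    instance
      a≢0 : NonZero a
      a≢0 = C-pos (suc n) k (m≤n⇒m≤1+n k≤n)
      b≢0 : NonZero b
      b≢0 = C-pos (suc n) (suc k) (s≤s k≤n)
      c≢0 : NonZero c
      c≢0 = C-pos n k k≤n
      ab≢0 : NonZero (a * b)
      ab≢0 = m*n≢0 a b
      [n+1]c≢0 : NonZero (suc n * c)
      [n+1]c≢0 = m*n≢0 (suc n) c
    cleared : (a + b) * (suc n * c) ≡ suc (suc n) * (a * b)
    cleared = begin
      (a + b) * (suc n * c)               ≡⟨ cong ((a + b) *_) ([k+1]*[n+1]C[k+1]≡[n+1]*nCk n k) ⟨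
      (a + b) * (suc k * b)               ≡⟨ *-assoc (a + b) (suc k) b ⟨
      ((a + b) * suc k) * b               ≡⟨ cong (_* b) (*-comm (a + b) (suc k)) ⟩
      (suc k * (a + b)) * b               ≡⟨ cong (λ x → suc k * x * b) (nCk+nC[k+1]≡[n+1]C[k+1] (suc n) k) ⟩
      (suc k * (suc (suc n) C suc k)) * b ≡⟨ cong (_* b) ([k+1]*[n+1]C[k+1]≡[n+1]*nCk (suc n) k) ⟩
      (suc (suc n) * a) * b               ≡⟨ *-assoc (suc (suc n)) a b ⟩
      suc (suc n) * (a * b)               ∎

  sum-init-last-toℕ : ∀ m (f : ℕ → ℚ) → ∑[ j < suc m ] f (toℕ j) ≡ (∑[ j < m ] f (toℕ j)) +ℚ f m
  sum-init-last-toℕ m f = trans (sum-init-last {m} (λ j → f (toℕ j)))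
    (cong₂ _+ℚ_ (sum-cong-≗ {m} (λ j → cong f (toℕ-inject₁ j))) (cong f (toℕ-fromℕ m)))

  module _ (φ : ℕ → ℚ) where

    binomialReciprocalSum : ℕ → ℚ
    binomialReciprocalSum n = ∑[ j < suc n ] (φ (2 + (n + toℕ j)) *ℚ recip (n C toℕ j))

    harmonicTerm : ℕ → ℚ
    harmonicTerm k = (φ k +ℚ φ (2 * k + 1)) *ℚ recip (suc k)

    harmonicSum : ℕ → ℚ
    harmonicSum n = ∑[ j < suc n ] harmonicTerm (toℕ j)

    binomialReciprocalSum-pascal : ∀ n →
      (∑[ j < suc n ] (φ (2 + (n + toℕ j)) *ℚ recip (suc n C toℕ j))) +ℚ
      (∑[ j < suc n ] (φ (2 + (n + toℕ j)) *ℚ recip (suc n C suc (toℕ j))))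
        ≡ toℚ (+ suc (suc n)) *ℚ (recip (suc n) *ℚ binomialReciprocalSum n)
    binomialReciprocalSum-pascal n = begin
      (∑[ j < suc n ] (h (toℕ j) *ℚ w′ (toℕ j))) +ℚ (∑[ j < suc n ] (h (toℕ j) *ℚ w′ (suc (toℕ j))))
        ≡⟨ ∑-distrib-+ {suc n} (λ j → h (toℕ j) *ℚ w′ (toℕ j)) (λ j → h (toℕ j) *ℚ w′ (suc (toℕ j))) ⟨
      ∑[ j < suc n ] (h (toℕ j) *ℚ w′ (toℕ j) +ℚ h (toℕ j) *ℚ w′ (suc (toℕ j)))
        ≡⟨ sum-cong-≗ {suc n} (λ j → pair (toℕ j) (toℕ≤pred[n] j)) ⟩
      ∑[ j < suc n ] (N *ℚ (r *ℚ (h (toℕ j) *ℚ w (toℕ j))))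
        ≡⟨ *-distribˡ-sum {suc n} N (λ j → r *ℚ (h (toℕ j) *ℚ w (toℕ j))) ⟨
      N *ℚ (∑[ j < suc n ] (r *ℚ (h (toℕ j) *ℚ w (toℕ j))))
        ≡⟨ cong (N *ℚ_) (*-distribˡ-sum {suc n} r (λ j → h (toℕ j) *ℚ w (toℕ j))) ⟨
      N *ℚ (r *ℚ binomialReciprocalSum n) ∎
      where
      N = toℚ (+ suc (suc n))
      r = recip (suc n)
      h w w′ : ℕ → ℚ
      h  k = φ (2 + (n + k))
      w  k = recip (n C k)
      w′ k = recip (suc n C k)
      pair : ∀ k → k ≤ n → h k *ℚ w′ k +ℚ h k *ℚ w′ (suc k) ≡ N *ℚ (r *ℚ (h k *ℚ w k))
      pair k k≤n = begin
        h k *ℚ w′ k +ℚ h k *ℚ w′ (suc k) ≡⟨ ℚ.*-distribˡ-+ (h k) (w′ k) (w′ (suc k)) ⟨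
        h k *ℚ (w′ k +ℚ w′ (suc k))      ≡⟨ cong (h k *ℚ_) (recip[n+1]Ck+recip[n+1]C[k+1] k≤n) ⟩
        h k *ℚ (N *ℚ (r *ℚ w k))         ≡⟨ solve 4 (λ H N r w → H :* (N :* (r :* w)) := N :* (r :* (H :* w)))
                                                  refl (h k) N r (w k) ⟩
        N *ℚ (r *ℚ (h k *ℚ w k))         ∎

    module _ (φ-rec : ∀ m → φ (2 + m) ≡ φ (1 + m) +ℚ φ m) where

      binomialReciprocalSum-suc : ∀ n → binomialReciprocalSum (suc n) ≡
        toℚ (+ suc (suc n)) *ℚ (recip (suc n) *ℚ binomialReciprocalSum n) +ℚ (φ (suc n) +ℚ φ (2 * suc n + 1))
      binomialReciprocalSum-suc n = begin
        binomialReciprocalSum (suc n)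
          ≡⟨ sum-cong-≗ {suc (suc n)} (λ j → split (toℕ j)) ⟩
        ∑[ j < suc (suc n) ] (h (toℕ j) *ℚ w′ (toℕ j) +ℚ h′ (toℕ j) *ℚ w′ (toℕ j))
          ≡⟨ ∑-distrib-+ {suc (suc n)} (λ j → h (toℕ j) *ℚ w′ (toℕ j)) (λ j → h′ (toℕ j) *ℚ w′ (toℕ j)) ⟩
        (∑[ j < suc (suc n) ] (h (toℕ j) *ℚ w′ (toℕ j))) +ℚ (∑[ j < suc (suc n) ] (h′ (toℕ j) *ℚ w′ (toℕ j)))
          ≡⟨ cong₂ _+ℚ_ dropLast dropFirst ⟩
        (X +ℚ h (suc n)) +ℚ (h′ 0 +ℚ Y)
          ≡⟨ solve 4 (λ X Y H H′ → (X :+ H) :+ (H′ :+ Y) := (X :+ Y) :+ (H′ :+ H)) refl X Y (h (suc n)) (h′ 0) ⟩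
        (X +ℚ Y) +ℚ (h′ 0 +ℚ h (suc n))
          ≡⟨ cong₂ (λ a b → (X +ℚ Y) +ℚ (φ (suc a) +ℚ φ b))
                   (+-identityʳ n) (2+[n+[1+n]]≡2*[1+n]+1 n) ⟩
        (X +ℚ Y) +ℚ (φ (suc n) +ℚ φ (2 * suc n + 1))
          ≡⟨ cong (_+ℚ (φ (suc n) +ℚ φ (2 * suc n + 1))) (binomialReciprocalSum-pascal n) ⟩
        toℚ (+ suc (suc n)) *ℚ (recip (suc n) *ℚ binomialReciprocalSum n) +ℚ (φ (suc n) +ℚ φ (2 * suc n + 1)) ∎
        where
        h h′ w′ : ℕ → ℚ
        h  k = φ (2 + (n + k))
        h′ k = φ (1 + (n + k))
        w′ k = recip (suc n C k)
        X = ∑[ j < suc n ] (h (toℕ j) *ℚ w′ (toℕ j))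
        Y = ∑[ j < suc n ] (h (toℕ j) *ℚ w′ (suc (toℕ j)))
        split : ∀ k → φ (2 + (suc n + k)) *ℚ w′ k ≡ h k *ℚ w′ k +ℚ h′ k *ℚ w′ k
        split k = trans (cong (_*ℚ w′ k) (φ-rec (suc (n + k)))) (ℚ.*-distribʳ-+ (w′ k) (h k) (h′ k))
        dropLast : ∑[ j < suc (suc n) ] (h (toℕ j) *ℚ w′ (toℕ j)) ≡ X +ℚ h (suc n)
        dropLast = trans (sum-init-last-toℕ (suc n) (λ k → h k *ℚ w′ k))
          (cong (X +ℚ_) (trans (cong (λ c → h (suc n) *ℚ recip c) (nCn≡1 (suc n))) (ℚ.*-identityʳ (h (suc n)))))
        dropFirst : ∑[ j < suc (suc n) ] (h′ (toℕ j) *ℚ w′ (toℕ j)) ≡ h′ 0 +ℚ Y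
        dropFirst = cong₂ _+ℚ_ (ℚ.*-identityʳ (h′ 0))
          (sum-cong-≗ {suc n} (λ j → cong (λ m → φ (suc m) *ℚ w′ (suc (toℕ j))) (+-suc n (toℕ j))))
        2+[n+[1+n]]≡2*[1+n]+1 : ∀ n → 2 + (n + suc n) ≡ 2 * suc n + 1
        2+[n+[1+n]]≡2*[1+n]+1 = solve-∀

      binomialReciprocalSum≡[n+1]*harmonicSum : ∀ n → binomialReciprocalSum n ≡ toℚ (+ suc n) *ℚ harmonicSum n
      binomialReciprocalSum≡[n+1]*harmonicSum zero = begin
        φ 2 *ℚ 1ℚ +ℚ 0ℚ                  ≡⟨ cong (λ t → t *ℚ 1ℚ +ℚ 0ℚ) (φ-rec 0) ⟩
        (φ 1 +ℚ φ 0) *ℚ 1ℚ +ℚ 0ℚ         ≡⟨ solve 2 (λ a b → (a :+ b) :* con 1ℚ :+ con 0ℚ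
                                                        := con 1ℚ :* ((b :+ a) :* con 1ℚ :+ con 0ℚ)) refl (φ 1) (φ 0) ⟩
        1ℚ *ℚ ((φ 0 +ℚ φ 1) *ℚ 1ℚ +ℚ 0ℚ) ∎
      binomialReciprocalSum≡[n+1]*harmonicSum (suc n) = begin
        binomialReciprocalSum (suc n)
          ≡⟨ binomialReciprocalSum-suc n ⟩
        N *ℚ (recip (suc n) *ℚ binomialReciprocalSum n) +ℚ e
          ≡⟨ cong (λ t → N *ℚ (recip (suc n) *ℚ t) +ℚ e) (binomialReciprocalSum≡[n+1]*harmonicSum n) ⟩
        N *ℚ (recip (suc n) *ℚ (toℚ (+ suc n) *ℚ harmonicSum n)) +ℚ e
          ≡⟨ cong₂ (λ a b → N *ℚ a +ℚ b) (recip[d]*[toℚ[d]*x]≡x (suc n) (harmonicSum n))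
                                          (sym (toℚ[d]*[x*recip[d]]≡x (suc (suc n)) e)) ⟩
        N *ℚ harmonicSum n +ℚ N *ℚ harmonicTerm (suc n)
          ≡⟨ ℚ.*-distribˡ-+ N (harmonicSum n) (harmonicTerm (suc n)) ⟨
        N *ℚ (harmonicSum n +ℚ harmonicTerm (suc n))
          ≡⟨ cong (N *ℚ_) (sum-init-last-toℕ (suc n) harmonicTerm) ⟨
        N *ℚ harmonicSum (suc n) ∎
        where
        N = toℚ (+ suc (suc n))
        e = φ (suc n) +ℚ φ (2 * suc n + 1)

open import Data.Nat using (ℕ; suc)
open import Data.Integer using (ℤ; +_; _+_; _-_; _*_)
open import Data.Rational using (ℚ; _/_) renaming (_*_ to _*ℚ_)
open import Data.Fin using (toℕ)
open import Data.Product using (_×_)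
open import Relation.Binary.PropositionalEquality using (_≡_)

open import Data.Nat as ℕ using (zero)
import Data.Nat.Properties as ℕ
open import Data.Nat.Combinatorics using (_C_)
open import Data.Integer using (-_; -[1+_])
open import Data.Integer.Properties using (pos-*)
open import Data.Integer.Tactic.RingSolver using (solve-∀)
open import Data.Fin using (Fin)
open import Data.Fin.Properties using (toℕ≤pred[n])
open import Data.Rational using () renaming (_+_ to _+ℚ_)
open import Data.Rational.Properties using (+-*-ring)
open import Algebra.Bundles using (Ring)
open import Algebra.Properties.Semiring.Sum (Ring.semiring +-*-ring) using (sum; sum-cong-≗)
open import Data.Product using (_,_)
open import Function using (_∘_)
open import Relation.Binary.PropositionalEquality using (refl; sym; trans; cong; cong₂; module ≡-Reasoning)
open ≡-Reasoning

Σ≡sum : ∀ {m} (f : Fin m → ℚ) → Σ m f ≡ sum f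
Σ≡sum {zero}  f = refl
Σ≡sum {suc m} f = cong (f Fin.zero +ℚ_) (Σ≡sum (λ j → f (Fin.suc j)))

-- At x = -(j+3) the recurrences unfold to this identity, with σ = sgn j (for F) or sgn (j+1) (for L),
-- since sgn (k+2) = - - sgn k.
σ*b≡-σ*a+--σ*[a+b] : ∀ σ a b → σ * b ≡ (- σ) * a + (- (- σ)) * (a + b)
σ*b≡-σ*a+--σ*[a+b] = solve-∀

F-rec : ∀ x → F (x + + 2) ≡ F (x + + 1) + F x
F-rec (+ m) rewrite ℕ.+-comm m 2 | ℕ.+-comm m 1 = refl
F-rec -[1+ 0 ] = refl
F-rec -[1+ 1 ] = refl
F-rec -[1+ suc (suc j) ] = σ*b≡-σ*a+--σ*[a+b] (sgn j) (fibℕ (suc (suc j))) (fibℕ (suc j))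

L-rec : ∀ x → L (x + + 2) ≡ L (x + + 1) + L x
L-rec (+ m) rewrite ℕ.+-comm m 2 | ℕ.+-comm m 1 = refl
L-rec -[1+ 0 ] = refl
L-rec -[1+ 1 ] = refl
L-rec -[1+ suc (suc j) ] = σ*b≡-σ*a+--σ*[a+b] (sgn (suc j)) (lucℕ (suc (suc j))) (lucℕ (suc j))

module _ (G : ℤ → ℤ) where

  shifted : ℤ → ℕ → ℚ
  shifted t m = toℚ (G (+ m + t))

  module _ (G-rec : ∀ x → G (x + + 2) ≡ G (x + + 1) + G x) where

    shifted-rec : ∀ t m → shifted t (2 ℕ.+ m) ≡ shifted t (1 ℕ.+ m) +ℚ shifted t m
    shifted-rec t m = begin
      toℚ (G (+ 2 + + m + t))                      ≡⟨ cong (toℚ ∘ G) (2+x+t≡x+t+2 (+ m) t) ⟩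
      toℚ (G (+ m + t + + 2))                      ≡⟨ cong toℚ (G-rec (+ m + t)) ⟩
      toℚ (G (+ m + t + + 1) + G (+ m + t))        ≡⟨ toℚ-homo-+ (G (+ m + t + + 1)) (G (+ m + t)) ⟩
      toℚ (G (+ m + t + + 1)) +ℚ toℚ (G (+ m + t)) ≡⟨ cong (λ x → toℚ (G x) +ℚ toℚ (G (+ m + t)))
                                                            (1+x+t≡x+t+1 (+ m) t) ⟨
      toℚ (G (+ 1 + + m + t)) +ℚ toℚ (G (+ m + t)) ∎
      where
      2+x+t≡x+t+2 : ∀ x t → + 2 + x + t ≡ x + t + + 2
      2+x+t≡x+t+2 = solve-∀
      1+x+t≡x+t+1 : ∀ x t → + 1 + x + t ≡ x + t + + 1
      1+x+t≡x+t+1 = solve-∀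

    reciprocalBinomialIdentity : (n : ℕ) (s : ℤ) →
      Σ (suc n) (λ j → G (+ toℕ j + + n + s) /C[ n , j ])
        ≡ (+ suc n / 1) *ℚ Σ (suc n) (λ j → (G (+ toℕ j + s - + 2) + G (+ 2 * + toℕ j + s - + 1)) / suc (toℕ j))
    reciprocalBinomialIdentity n s = begin
      Σ (suc n) lhsTerm                   ≡⟨ Σ≡sum lhsTerm ⟩
      sum lhsTerm                         ≡⟨ sum-cong-≗ lhsTerm≡ ⟩
      binomialReciprocalSum φ n           ≡⟨ binomialReciprocalSum≡[n+1]*harmonicSum φ (shifted-rec t) n ⟩
      toℚ (+ suc n) *ℚ harmonicSum φ n    ≡⟨ cong (toℚ (+ suc n) *ℚ_) (sum-cong-≗ rhsTerm≡) ⟨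
      toℚ (+ suc n) *ℚ sum rhsTerm        ≡⟨ cong (toℚ (+ suc n) *ℚ_) (Σ≡sum rhsTerm) ⟨
      toℚ (+ suc n) *ℚ Σ (suc n) rhsTerm  ∎
      where
      t = s - + 2
      φ = shifted t
      lhsTerm rhsTerm : Fin (suc n) → ℚ
      lhsTerm j = G (+ toℕ j + + n + s) /C[ n , j ]
      rhsTerm j = (G (+ toℕ j + s - + 2) + G (+ 2 * + toℕ j + s - + 1)) / suc (toℕ j)
      lhsTerm≡ : ∀ j → lhsTerm j ≡ φ (2 ℕ.+ (n ℕ.+ toℕ j)) *ℚ recip (n C toℕ j)
      lhsTerm≡ j = trans
        (z/d≡toℚ[z]*recip[d] (G (+ toℕ j + + n + s)) (n C toℕ j) {{C-pos n (toℕ j) (toℕ≤pred[n] j)}})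
        (cong (λ x → toℚ (G x) *ℚ recip (n C toℕ j)) (k+n+s≡2+[n+k]+[s-2] (+ toℕ j) (+ n) s))
        where
        k+n+s≡2+[n+k]+[s-2] : ∀ k n s → k + n + s ≡ + 2 + (n + k) + (s - + 2)
        k+n+s≡2+[n+k]+[s-2] = solve-∀
      rhsTerm≡ : ∀ j → rhsTerm j ≡ harmonicTerm φ (toℕ j)
      rhsTerm≡ j = begin
        (G (+ k + s - + 2) + G (+ 2 * + k + s - + 1)) / suc k
          ≡⟨ z/d≡toℚ[z]*recip[d] (G (+ k + s - + 2) + G (+ 2 * + k + s - + 1)) (suc k) ⟩
        toℚ (G (+ k + s - + 2) + G (+ 2 * + k + s - + 1)) *ℚ recip (suc k)
          ≡⟨ cong (_*ℚ recip (suc k)) (toℚ-homo-+ (G (+ k + s - + 2)) (G (+ 2 * + k + s - + 1))) ⟩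
        (toℚ (G (+ k + s - + 2)) +ℚ toℚ (G (+ 2 * + k + s - + 1))) *ℚ recip (suc k)
          ≡⟨ cong₂ (λ x y → (toℚ (G x) +ℚ toℚ (G y)) *ℚ recip (suc k)) (x+s-2≡x+[s-2] (+ k) s)
               (trans (x+s-1≡x+1+[s-2] (+ 2 * + k) s) (cong (λ x → x + + 1 + t) (sym (pos-* 2 k)))) ⟩
        harmonicTerm φ k ∎
        where
        k = toℕ j
        x+s-2≡x+[s-2] : ∀ x s → x + s - + 2 ≡ x + (s - + 2)
        x+s-2≡x+[s-2] = solve-∀
        x+s-1≡x+1+[s-2] : ∀ x s → x + s - + 1 ≡ x + + 1 + (s - + 2)
        x+s-1≡x+1+[s-2] = solve-∀

theorem1 : (n : ℕ) (s : ℤ) →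
    (Σ (suc n) (λ j → F (+ toℕ j + + n + s) /C[ n , j ])
      ≡ (+ suc n / 1) *ℚ Σ (suc n) (λ j → (F (+ toℕ j + s - + 2) + F (+ 2 * + toℕ j + s - + 1)) / suc (toℕ j)))
    × (Σ (suc n) (λ j → L (+ toℕ j + + n + s) /C[ n , j ])
      ≡ (+ suc n / 1) *ℚ Σ (suc n) (λ j → (L (+ toℕ j + s - + 2) + L (+ 2 * + toℕ j + s - + 1)) / suc (toℕ j)))
theorem1 n s = reciprocalBinomialIdentity F F-rec n s , reciprocalBinomialIdentity L L-rec n s
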